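{- Let $\mathbb P$ be a large-tree forcing notion, $S\in\mathbb P$, $\langle R,R'\rangle\in\mathbb P\times_{\mathsf E_0}\mathbb P$, and let $c$ be a $\mathbb P\times_{\mathsf E_0}\mathbb P$-real name. Then there exist a tree $S'\in\mathbb P$ with $S'\subseteq S$ and a condition $\langle T,T'\rangle\in\mathbb P\times_{\mathsf E_0}\mathbb P$ with $\langle T,T'\rangle\le\langle R,R'\rangle$ which directly forces $c\notin[S']$.
   Context: For $s,t\in 2^{<\omega}$ with $\mathrm{lh}(s)\le\mathrm{lh}(t)$, $s\cdot t$ has length $\mathrm{lh}(t)$ with $(s\cdot t)(k)=t(k)+s(k)\bmod2$ for $k<\mathrm{lh}(s)$, $=t(k)$ otherwise; if $\mathrm{lh}(s)>\mathrm{lh}(t)$, $s\cdot t=(s{\restriction}\mathrm{lh}(t))\cdot t$; $s\cdot T=\{s\cdot t:t\in T\}$; $T{\restriction}s=\{t\in T:s\subseteq t\lor t\subseteq s\}$; $[T]$ is the set of infinite branches. The stem of a perfect tree $T$ is the largest $s\in T$ with $T=T{\restriction}s$. $\mathbf{LT}$ is the set of perfect trees $T\subseteq2^{<\omega}$ for which there are nonempty strings $q^m_i$ ($m<\omega,i<2$) with $\mathrm{lh}(q^m_0)=\mathrm{lh}(q^m_1)$, $q^m_i(0)=i$, such that $T$ consists of all initial segments of strings $\mathrm{stem}(T)^\frown q^0_{i(0)}{}^\frown\cdots{}^\frown q^m_{i(m)}$. A large-tree forcing notion is a set $\mathbb P\subseteq\mathbf{LT}$ closed under $T\mapsto T{\restriction}u$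 ($u\in T$) and $T\mapsto s\cdot T$. $\mathbb P\times_{\mathsf E_0}\mathbb P$ is the set of pairs $\langle T,T'\rangle$ of trees in $\mathbb P$ with $T'=\sigma\cdot T$ for some $\sigma\in2^{<\omega}$, ordered componentwise by inclusion; $\mathbf{LT}\times_{\mathsf E_0}\mathbf{LT}$ is defined likewise. A $\mathbb P\times_{\mathsf E_0}\mathbb P$-real name is a system $c=\langle C^n_i:n<\omega,i<2\rangle$ of sets $C^n_i\subseteq\mathbb P\times_{\mathsf E_0}\mathbb P$ such that each $C^n_0\cup C^n_1$ is pre-dense in $\mathbb P\times_{\mathsf E_0}\mathbb P$ and any element of $C^n_0$ is incompatible in $\mathbb P\times_{\mathsf E_0}\mathbb P$ with any element of $C^n_1$. A condition $\langle T,T'\rangle\in\mathbf{LT}\times_{\mathsf E_0}\mathbf{LT}$ directly forces $c(n)=i$ if $\langle T,T'\rangle\le\langle S,S'\rangle$ for some $\langle S,S'\rangle\in C^n_i$; it directly forces $s\subset c$ ($s\in2^{<\omega}$) if it directly forces $c(n)=s(n)$ for all $n<\mathrm{lh}(s)$; it directly forces $c\notin[U]$ (for a perfect tree $U$) if there is $s\in2^{<\omega}\setminus U$ such that it directly forces $s\subset c$. -}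

module Defs where

open import Data.Bool using (Bool; true; false; _xor_)
open import Data.List using (List; []; _∷_; _++_; length; lookup)
open import Data.Nat using (ℕ; zero; suc; _≤_)
open import Data.Fin using (Fin; toℕ)
open import Data.Product using (Σ; ∃; _×_; _,_)
open import Data.Sum using (_⊎_)
open import Relation.Binary.PropositionalEquality using (_≡_)
open import Relation.Nullary using (¬_)

Str : Set
Str = List Bool

_⊑_ : Str → Str → Set
s ⊑ t = ∃ λ u → s ++ u ≡ t

_·_ : Str → Str → Str
[] · t = t
(a ∷ s) · [] = []
(a ∷ s) · (b ∷ t) = (b xor a) ∷ (s · t)

StrSet : Set₁
StrSet = Str → Set

_⊆_ : StrSet → StrSet → Set
T ⊆ U = ∀ t → T t → U t

_≐_ : StrSet → StrSet → Set
T ≐ U = T ⊆ U × U ⊆ T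

_·T_ : Str → StrSet → StrSet
(s ·T T) t = ∃ λ t' → T t' × s · t' ≡ t

_↾_ : StrSet → Str → StrSet
(T ↾ s) t = T t × (s ⊑ t ⊎ t ⊑ s)

IsTree : StrSet → Set
IsTree T = T [] × (∀ s t → s ⊑ t → T t → T s)

IsPerfect : StrSet → Set
IsPerfect T = IsTree T ×
  (∀ s → T s → ∃ λ t → ∃ λ u → T t × T u × s ⊑ t × s ⊑ u × ¬ (t ⊑ u) × ¬ (u ⊑ t))

restr : (ℕ → Bool) → ℕ → Str
restr x zero = []
restr x (suc n) = x zero ∷ restr (λ k → x (suc k)) n

Branches : StrSet → (ℕ → Bool) → Set
Branches T x = ∀ n → T (restr x n)

IsStem : StrSet → Str → Set
IsStem T s = T s × T ≐ (T ↾ s) × (∀ s' → T s' → T ≐ (T ↾ s') → length s' ≤ length s)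

build : (ℕ → Bool → Str) → (ℕ → Bool) → ℕ → Str
build q i zero = q zero (i zero)
build q i (suc m) = q zero (i zero) ++ build (λ k → q (suc k)) (λ k → i (suc k)) m

IsLT : StrSet → Set
IsLT T = IsPerfect T × Σ Str λ stm → IsStem T stm ×
  Σ (ℕ → Bool → Str) λ q →
    (∀ m b → ¬ (q m b ≡ [])) ×
    (∀ m → length (q m false) ≡ length (q m true)) ×
    (∀ m b → ∃ λ r → q m b ≡ b ∷ r) ×
    (∀ t → T t → ∃ λ m → ∃ λ i → t ⊑ (stm ++ build q i m)) ×
    (∀ t m i → t ⊑ (stm ++ build q i m) → T t)

Forcing : Set₂
Forcing = StrSet → Set₁

-- P respects extensional equality of trees (automatic for sets of sets)
Extensional : Forcing → Set₁
Extensional P = ∀ T U → T ≐ U → P T → P U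

IsLargeTreeForcing : Forcing → Set₁
IsLargeTreeForcing P =
  (∀ T → P T → IsLT T) ×
  (∀ T u → P T → T u → P (T ↾ u)) ×
  (∀ T s → P T → P (s ·T T))

CondE0 : Forcing → StrSet → StrSet → Set₁
CondE0 P T T' = P T × P T' × Σ Str λ σ → T' ≐ (σ ·T T)

CondLT : StrSet → StrSet → Set
CondLT T T' = IsLT T × IsLT T' × Σ Str λ σ → T' ≐ (σ ·T T)

_,_≤c_,_ : StrSet → StrSet → StrSet → StrSet → Set
T , T' ≤c S , S' = T ⊆ S × T' ⊆ S'

Compatible : Forcing → StrSet → StrSet → StrSet → StrSet → Set₁
Compatible P T T' S S' = Σ StrSet λ U → Σ StrSet λ U' →
  CondE0 P U U' × (U , U' ≤c T , T') × (U , U' ≤c S , S')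

-- a system of sets C^n_i of pairs of trees
Name : Set₂
Name = ℕ → Bool → StrSet → StrSet → Set₁

IsRealName : Forcing → Name → Set₁
IsRealName P c =
  (∀ n i S S' → c n i S S' → CondE0 P S S') ×
  (∀ n T T' → CondE0 P T T' →
     Σ Bool λ i → Σ StrSet λ S → Σ StrSet λ S' → c n i S S' × Compatible P T T' S S') ×
  (∀ n S S' V V' → c n false S S' → c n true V V' → ¬ Compatible P S S' V V')

DForcesVal : Name → StrSet → StrSet → ℕ → Bool → Set₁
DForcesVal c T T' n i = Σ StrSet λ S → Σ StrSet λ S' → c n i S S' × (T , T' ≤c S , S')

DForcesPrefix : Name → StrSet → StrSet → Str → Set₁
DForcesPrefix c T T' s = (k : Fin (length s)) → DForcesVal c T T' (toℕ k) (lookup s k)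

DForcesNotIn : Name → StrSet → StrSet → StrSet → Set₁
DForcesNotIn c T T' U = Σ Str λ s → ¬ U s × DForcesPrefix c T T' s

module Submission where

-- (1) Escaping a tree.  A perfect tree S ∈ ℙ has two incomparable nodes t, u.
--     Put N = |t| + |u|.  Every string s of length N fails to be an initial
--     segment of t or of u (prefixes of s are comparable), and being long it
--     cannot lie below that node either; so s ∉ S ↾ t or s ∉ S ↾ u, and both
--     restrictions are members of ℙ contained in S.
--
-- (2) Deciding initial segments.  Since each C^n_0 ∪ C^n_1 is pre-dense, any
--     condition can be strengthened to directly force a value of c(n).  By
--     induction on n, below ⟨R,R'⟩ there is a condition directly forcing
--     s ⊂ c for some s of length n.
--
-- The theorem: take N from (1), use (2) to get ⟨T,T'⟩ ≤ ⟨R,R'⟩ directly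
-- forcing some s ⊂ c with |s| = N, and let S' be the restriction of S given
-- by (1) that omits s; then ⟨T,T'⟩ directly forces c ∉ [S'].

open import Defs
open import Data.Bool using (Bool; _≟_)
open import Data.Empty using (⊥-elim)
open import Data.Fin using (Fin; toℕ)
import Data.Fin as Fin
open import Data.List using ([]; _∷_; _++_; length; lookup)
open import Data.List.Properties using (∷-injective; length-++)
open import Data.List.Relation.Binary.Prefix.Heterogeneous.Properties using (prefix?)
open import Data.List.Relation.Binary.Prefix.Propositional.Properties
  using (Prefix-as-∣ˡ; ∣ˡ-as-Prefix)
open import Data.Nat using (ℕ; zero; suc; _+_; _≤_; s≤s)
open import Data.Nat.Properties using (+-identityʳ; +-suc; +-comm; m≤m+n; m≤n+m)
open import Data.Product using (Σ; _×_; _,_; proj₁; proj₂)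
open import Data.Sum using (_⊎_; inj₁; inj₂)
open import Data.Unit.Polymorphic using (⊤; tt)
open import Relation.Nullary using (¬_; Dec; yes; no)
import Relation.Nullary.Decidable as Dec
-- the library states the prefix relation as left divisibility in the monoid
-- (Str, _++_, []); _∣,_ is the constructor of that divisibility record
open import Algebra.Definitions.RawMagma using (module _∣ˡ_) renaming (_,_ to _∣,_)
open import Relation.Binary.PropositionalEquality
  using (_≡_; refl; cong; subst; sym; trans)

⊑-dec : (t s : Str) → Dec (t ⊑ s)
⊑-dec t s = Dec.map′ (λ p → let q ∣, e = Prefix-as-∣ˡ p in q , e)
                     (λ { (q , e) → ∣ˡ-as-Prefix (q ∣, e) })
                     (prefix? _≟_ t s)

⊑-long⇒⊒ : ∀ s v → length (s ++ v) ≤ length s → (s ++ v) ⊑ s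
⊑-long⇒⊒ []      []      _         = [] , refl
⊑-long⇒⊒ (a ∷ s) v       (s≤s len) =
  let w , e = ⊑-long⇒⊒ s v len in w , cong (a ∷_) e

⊑-antisym-length : ∀ {s t} → s ⊑ t → length t ≤ length s → t ⊑ s
⊑-antisym-length {s} (v , refl) = ⊑-long⇒⊒ s v

⊑-comparable : ∀ t u s → t ⊑ s → u ⊑ s → t ⊑ u ⊎ u ⊑ t
⊑-comparable []      u       s       _        _        = inj₁ (u , refl)
⊑-comparable (a ∷ t) []      s       _        _        = inj₂ (a ∷ t , refl)
⊑-comparable (a ∷ t) (b ∷ u) []      (_ , ()) _
⊑-comparable (a ∷ t) (b ∷ u) (_ ∷ s) (v , e)  (w , f)
  with refl , e' ← ∷-injective e | refl , f' ← ∷-injective f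
  with ⊑-comparable t u s (v , e') (w , f')
... | inj₁ (x , g) = inj₁ (x , cong (a ∷_) g)
... | inj₂ (x , g) = inj₂ (x , cong (a ∷_) g)

∉↾ : ∀ (T : StrSet) {t s} → length t ≤ length s → ¬ t ⊑ s → ¬ (T ↾ t) s
∉↾ T _   t⋢s (_ , inj₁ t⊑s) = t⋢s t⊑s
∉↾ T len t⋢s (_ , inj₂ s⊑t) = t⋢s (⊑-antisym-length s⊑t len)

avoid-one-side : ∀ (T : StrSet) t u s → ¬ t ⊑ u → ¬ u ⊑ t →
  length t ≤ length s → length u ≤ length s → ¬ (T ↾ t) s ⊎ ¬ (T ↾ u) s
avoid-one-side T t u s t⋢u u⋢t lt lu with ⊑-dec t s | ⊑-dec u s
... | no t⋢s | _      = inj₁ (∉↾ T lt t⋢s)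
... | yes _  | no u⋢s = inj₂ (∉↾ T lu u⋢s)
... | yes t⊑s | yes u⊑s with ⊑-comparable t u s t⊑s u⊑s
...   | inj₁ t⊑u = ⊥-elim (t⋢u t⊑u)
...   | inj₂ u⊑t = ⊥-elim (u⋢t u⊑t)

escape : (P : Forcing) → IsLargeTreeForcing P → (S : StrSet) → P S →
  Σ ℕ λ N → ∀ s → length s ≡ N → Σ StrSet λ S' → P S' × S' ⊆ S × ¬ S' s
escape P (isLT , restrict , _) S PS =
  length t + length u , λ s len →
    let lt = subst (length t ≤_) (sym len) (m≤m+n (length t) (length u))
        lu = subst (length u ≤_) (sym len) (m≤n+m (length u) (length t))
    in  omit s (avoid-one-side S t u s t⋢u u⋢t lt lu)
  where
  perfect = proj₁ (isLT S PS)
  split   = proj₂ perfect [] (proj₁ (proj₁ perfect))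
  t = proj₁ split
  u = proj₁ (proj₂ split)
  St : S t
  St = proj₁ (proj₂ (proj₂ split))
  Su : S u
  Su = proj₁ (proj₂ (proj₂ (proj₂ split)))
  t⋢u : ¬ t ⊑ u
  t⋢u = proj₁ (proj₂ (proj₂ (proj₂ (proj₂ (proj₂ (proj₂ split))))))
  u⋢t : ¬ u ⊑ t
  u⋢t = proj₂ (proj₂ (proj₂ (proj₂ (proj₂ (proj₂ (proj₂ split))))))

  omit : ∀ s → ¬ (S ↾ t) s ⊎ ¬ (S ↾ u) s →
    Σ StrSet λ S' → P S' × S' ⊆ S × ¬ S' s
  omit s (inj₁ ∉t) = S ↾ t , restrict S t PS St , (λ _ → proj₁) , ∉t
  omit s (inj₂ ∉u) = S ↾ u , restrict S u PS Su , (λ _ → proj₁) , ∉u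

≤c-refl : ∀ T T' → T , T' ≤c T , T'
≤c-refl T T' = (λ _ x → x) , (λ _ x → x)

≤c-trans : ∀ {T T' U U' V V'} →
  T , T' ≤c U , U' → U , U' ≤c V , V' → T , T' ≤c V , V'
≤c-trans (tu , tu') (uv , uv') = (λ x p → uv x (tu x p)) , (λ x p → uv' x (tu' x p))

forcesVal-mono : ∀ c {T T' U U'} n i →
  U , U' ≤c T , T' → DForcesVal c T T' n i → DForcesVal c U U' n i
forcesVal-mono c n i U≤T (S , S' , mem , T≤S) = S , S' , mem , ≤c-trans U≤T T≤S

decide-value : (P : Forcing) (c : Name) → IsRealName P c →
  ∀ {T T'} → CondE0 P T T' → ∀ n →
  Σ Bool λ i → Σ StrSet λ U → Σ StrSet λ U' →
    CondE0 P U U' × (U , U' ≤c T , T') × DForcesVal c U U' n i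
decide-value P c (_ , dense , _) cT n
  with dense n _ _ cT
... | i , S , S' , mem , U , U' , cU , U≤T , U≤S = i , U , U' , cU , U≤T , S , S' , mem , U≤S

ForcesFrom : Name → StrSet → StrSet → ℕ → Str → Set₁
ForcesFrom c T T' off []      = ⊤
ForcesFrom c T T' off (b ∷ s) = DForcesVal c T T' off b × ForcesFrom c T T' (suc off) s

forcesFrom-mono : ∀ c {T T' U U'} off s →
  U , U' ≤c T , T' → ForcesFrom c T T' off s → ForcesFrom c U U' off s
forcesFrom-mono c off []      _   _        = tt
forcesFrom-mono c off (b ∷ s) U≤T (d , ds) =
  forcesVal-mono c off b U≤T d , forcesFrom-mono c (suc off) s U≤T ds

forcesFrom-snoc : ∀ c {T T'} off s i → ForcesFrom c T T' off s →
  DForcesVal c T T' (off + length s) i → ForcesFrom c T T' off (s ++ i ∷ [])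
forcesFrom-snoc c {T} {T'} off [] i _ d =
  subst (λ k → DForcesVal c T T' k i) (+-identityʳ off) d , tt
forcesFrom-snoc c {T} {T'} off (b ∷ s) i (d₀ , ds) d =
  d₀ , forcesFrom-snoc c (suc off) s i ds
         (subst (λ k → DForcesVal c T T' k i) (+-suc off (length s)) d)

forcesFrom-lookup : ∀ c {T T'} off s → ForcesFrom c T T' off s →
  (k : Fin (length s)) → DForcesVal c T T' (off + toℕ k) (lookup s k)
forcesFrom-lookup c {T} {T'} off (b ∷ s) (d , _) Fin.zero =
  subst (λ k → DForcesVal c T T' k b) (sym (+-identityʳ off)) d
forcesFrom-lookup c {T} {T'} off (b ∷ s) (_ , ds) (Fin.suc k) =
  subst (λ m → DForcesVal c T T' m (lookup s k)) (sym (+-suc off (toℕ k)))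
        (forcesFrom-lookup c (suc off) s ds k)

forcesFrom⇒prefix : ∀ c {T T'} s → ForcesFrom c T T' 0 s → DForcesPrefix c T T' s
forcesFrom⇒prefix c s = forcesFrom-lookup c 0 s

decide-prefix : (P : Forcing) (c : Name) → IsRealName P c →
  ∀ {R R'} → CondE0 P R R' → ∀ n →
  Σ StrSet λ T → Σ StrSet λ T' → CondE0 P T T' × (T , T' ≤c R , R') ×
    Σ Str λ s → length s ≡ n × DForcesPrefix c T T' s
decide-prefix P c name {R} {R'} cR n =
  let T , T' , cT , T≤R , s , len , forced = go n
  in  T , T' , cT , T≤R , s , len , forcesFrom⇒prefix c s forced
  where
  go : ∀ n → Σ StrSet λ T → Σ StrSet λ T' → CondE0 P T T' × (T , T' ≤c R , R') ×
         Σ Str λ s → length s ≡ n × ForcesFrom c T T' 0 s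
  go zero = R , R' , cR , ≤c-refl R R' , [] , refl , tt
  go (suc n) with go n
  ... | T , T' , cT , T≤R , s , len , forced
      with decide-value P c name cT (length s)
  ...   | i , U , U' , cU , U≤T , d =
    U , U' , cU , ≤c-trans U≤T T≤R , s ++ i ∷ [] ,
    trans (length-++ s) (trans (+-comm (length s) 1) (cong suc len)) ,
    forcesFrom-snoc c 0 s i (forcesFrom-mono c 0 s U≤T forced) d

lemma9p1 : (P : Forcing) → IsLargeTreeForcing P → Extensional P →
    (S : StrSet) → P S →
    (R R' : StrSet) → CondE0 P R R' →
    (c : Name) → IsRealName P c →
    Σ StrSet λ S' → P S' × S' ⊆ S ×
      Σ StrSet λ T → Σ StrSet λ T' →
        CondE0 P T T' × (T , T' ≤c R , R') × DForcesNotIn c T T' S'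
lemma9p1 P large _ S PS R R' cR c name =
  let N , escapeAt = escape P large S PS
      T , T' , cT , T≤R , s , len , forced = decide-prefix P c name cR N
      S' , PS' , S'⊆S , s∉S' = escapeAt s len
  in  S' , PS' , S'⊆S , T , T' , cT , T≤R , s , s∉S' , forced
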